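{- Let $n\ge 3$ and let $L^n$ be the symmetric $(n-1)\times(n-1)$ matrix over $\mathbb{Z}[x_1,\ldots,x_n]$ with entries $$L^n_{i,i+j}=L^n_{i+j,i}=x_{i+1}x_{i+2}\cdots x_{i+j}\,(1-x_1^2x_2^2\cdots x_i^2)(1-x_{i+j+1}^2x_{i+j+2}^2\cdots x_n^2)$$ for $i\ge 1$, $j\ge 0$, $i+j\le n-1$. Then $$\det(L^n)=(1-x_1^2)(1-x_2^2)\cdots(1-x_n^2)\,(1-x_1^2x_2^2\cdots x_n^2)^{n-2}.$$ -}

module Defs where

open import Level using (Level)
open import Algebra.Bundles using (CommutativeRing)
open import Data.Nat using (ℕ; zero; suc; _∸_; _⊓_; _⊔_; _<ᵇ_; _≤ᵇ_)
open import Data.Fin using (Fin; zero; suc; toℕ; punchIn)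
open import Data.Bool using (if_then_else_; _∧_)

module _ {c ℓ : Level} (R : CommutativeRing c ℓ) where
  open CommutativeRing R using (Carrier; _+_; _*_; -_; _-_; 0#; 1#)

  pow : Carrier → ℕ → Carrier
  pow r zero = 1#
  pow r (suc k) = r * pow r k

  sumFin : (n : ℕ) → (Fin n → Carrier) → Carrier
  sumFin zero f = 0#
  sumFin (suc n) f = f zero + sumFin n (λ k → f (suc k))

  prodFin : (n : ℕ) → (Fin n → Carrier) → Carrier
  prodFin zero f = 1#
  prodFin (suc n) f = f zero * prodFin n (λ k → f (suc k))

  det : (m : ℕ) → (Fin m → Fin m → Carrier) → Carrier
  det zero M = 1#
  det (suc m) M =
    sumFin (suc m) (λ j → pow (- 1#) (toℕ j) * (M zero j
                     * det m (λ i k → M (suc i) (punchIn j k))))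

  -- variables x_1 … x_n are given as x : Fin n → R, with x_k = x (k-1).
  -- prodX n x a b = x_{a+1} x_{a+2} ⋯ x_b   (empty product = 1 if b ≤ a)
  prodX : (n : ℕ) → (Fin n → Carrier) → ℕ → ℕ → Carrier
  prodX n x a b = prodFin n (λ k →
    if (a <ᵇ suc (toℕ k)) ∧ (suc (toℕ k) ≤ᵇ b) then x k else 1#)

  prodSqX : (n : ℕ) → (Fin n → Carrier) → ℕ → ℕ → Carrier
  prodSqX n x a b = prodFin n (λ k →
    if (a <ᵇ suc (toℕ k)) ∧ (suc (toℕ k) ≤ᵇ b) then x k * x k else 1#)

  -- entry with 1-based indices i ≤ i' (i' = i + j):
  -- x_{i+1}⋯x_{i'} (1 - x_1^2⋯x_i^2)(1 - x_{i'+1}^2⋯x_n^2)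
  Lentry : (n : ℕ) → (Fin n → Carrier) → ℕ → ℕ → Carrier
  Lentry n x i i' = prodX n x i i' * ((1# - prodSqX n x 0 i) * (1# - prodSqX n x i' n))

  -- the symmetric (n-1)×(n-1) matrix L^n; row/column a : Fin (n-1) is index toℕ a + 1
  L : (n : ℕ) → (Fin n → Carrier) → Fin (n ∸ 1) → Fin (n ∸ 1) → Carrier
  L n x a b = Lentry n x (suc (toℕ a ⊓ toℕ b)) (suc (toℕ a ⊔ toℕ b))

  rhs : (n : ℕ) → (Fin n → Carrier) → Carrier
  rhs n x = prodFin n (λ k → 1# - x k * x k) * pow (1# - prodSqX n x 0 n) (n ∸ 2)

-- Lⁿ is a Green matrix: for i ≤ j its (i, j) entry is γ i j · α i · β j with
-- γ i j = y i ⋯ y (j - 1). After pulling α₀ out of the first column, the first two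
-- columns are proportional below the first row, so the Laplace expansion along that
-- row keeps only two terms, which combine into a single determinant of size one less
-- (a condensation step). Its first column is the pivot β₀α₁ - y₀²α₀β₁ times that of
-- the matrix of the same kind built from the shifted data, hence
-- det = α₀ · (product of the pivots) · β_last. For Lⁿ the s-th pivot factors as
-- (1 - x_{s+2}²)(1 - x₁² ⋯ x_n²).

module Submission where

open import Defs
open import Level using (Level)
open import Algebra.Bundles using (CommutativeRing)
open import Data.Nat using (ℕ; _≤_; _∸_)
open import Data.Fin using (Fin)

open import Data.Nat using (zero; suc; _<_; _⊓_; _⊔_; z≤n; s≤s)
open import Data.Nat.Properties using (n≤1+n; <⇒≤)
open import Data.Fin using (zero; suc; toℕ; punchIn; inject₁; fromℕ)
open import Data.Fin.Properties using (toℕ<n; toℕ-inject₁; toℕ-fromℕ)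
open import Function using (_∘_)
import Relation.Binary.PropositionalEquality as P
open P using (_≡_)
import Algebra.Properties.Semiring.Sum as SemiringSum
import Algebra.Properties.CommutativeMonoid.Sum as CommutativeMonoidSum
import Algebra.Properties.CommutativeSemigroup as CommutativeSemigroupProperties

module _ {c ℓ : Level} (R : CommutativeRing c ℓ) where
  open CommutativeRing R hiding (zero)
  open import Algebra.Properties.Ring ring
    using (-1*x≈-x; -‿distribˡ-*; x[y-z]≈xy-xz; [y-z]x≈yx-zx; ⁻¹-anti-homo‿-; -‿+-comm;
           x∙y⁻¹≈ε⇒x≈y; x≈y⇒x∙y⁻¹≈ε)
  open CommutativeSemigroupProperties +-commutativeSemigroup using (interchange)
  open CommutativeSemigroupProperties *-commutativeSemigroup using (x∙yz≈y∙xz; xy∙z≈xz∙y)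
  open import Algebra.Solver.Ring.NaturalCoefficients.Default commutativeSemiring
  open import Relation.Binary.Reasoning.Setoid setoid
  module Sum = SemiringSum semiring
  module Product = CommutativeMonoidSum *-commutativeMonoid

  [w-x]-[y-z]≈[w+z]-[x+y] : ∀ w x y z → (w - x) - (y - z) ≈ (w + z) - (x + y)
  [w-x]-[y-z]≈[w+z]-[x+y] w x y z = begin
    (w - x) - (y - z)      ≈⟨ +-congˡ (⁻¹-anti-homo‿- y z) ⟩
    (w - x) + (z - y)      ≈⟨ interchange w (- x) z (- y) ⟩
    (w + z) + (- x + - y)  ≈⟨ +-congˡ (-‿+-comm x y) ⟩
    (w + z) - (x + y)      ∎

  [w-x][y-z]≈[wy+xz]-[wz+xy] : ∀ w x y z → (w - x) * (y - z) ≈ (w * y + x * z) - (w * z + x * y)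
  [w-x][y-z]≈[wy+xz]-[wz+xy] w x y z = begin
    (w - x) * (y - z)                  ≈⟨ x[y-z]≈xy-xz (w - x) y z ⟩
    (w - x) * y - (w - x) * z          ≈⟨ +-cong ([y-z]x≈yx-zx y w x) (-‿cong ([y-z]x≈yx-zx z w x)) ⟩
    (w * y - x * y) - (w * z - x * z)  ≈⟨ [w-x]-[y-z]≈[w+z]-[x+y] _ _ _ _ ⟩
    (w * y + x * z) - (x * y + w * z)  ≈⟨ +-congˡ (-‿cong (+-comm _ _)) ⟩
    (w * y + x * z) - (w * z + x * y)  ∎

  w+z≈y+x⇒w-x≈y-z : ∀ {w x y z} → w + z ≈ y + x → w - x ≈ y - z
  w+z≈y+x⇒w-x≈y-z {w} {x} {y} {z} eq = x∙y⁻¹≈ε⇒x≈y _ _ (begin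
    (w - x) - (y - z)  ≈⟨ [w-x]-[y-z]≈[w+z]-[x+y] w x y z ⟩
    (w + z) - (x + y)  ≈⟨ +-cong eq (-‿cong (+-comm x y)) ⟩
    (y + x) - (y + x)  ≈⟨ -‿inverseʳ _ ⟩
    0#                 ∎)

  -- Expanding both sides into a difference of subtraction-free polynomials
  -- reduces the identity to one the semiring solver can check.
  [1-zb][1-az]-z[1-a][1-b]≈[1-z][1-azb] : ∀ a z b →
    (1# - z * b) * (1# - a * z) - z * (1# - a) * (1# - b) ≈ (1# - z) * (1# - a * (z * b))
  [1-zb][1-az]-z[1-a][1-b]≈[1-z][1-azb] a z b = begin
    (1# - z * b) * (1# - a * z) - z * (1# - a) * (1# - b)
      ≈⟨ +-cong ([w-x][y-z]≈[wy+xz]-[wz+xy] 1# (z * b) 1# (a * z))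
                (-‿cong (trans (*-congʳ (x[y-z]≈xy-xz z 1# a))
                               ([w-x][y-z]≈[wy+xz]-[wz+xy] (z * 1#) (z * a) 1# b))) ⟩
    ((1# * 1# + z * b * (a * z)) - (1# * (a * z) + z * b * 1#))
      - ((z * 1# * 1# + z * a * b) - (z * 1# * b + z * a * 1#))
      ≈⟨ [w-x]-[y-z]≈[w+z]-[x+y] _ _ _ _ ⟩
    ((1# * 1# + z * b * (a * z)) + (z * 1# * b + z * a * 1#))
      - ((1# * (a * z) + z * b * 1#) + (z * 1# * 1# + z * a * b))
      ≈⟨ w+z≈y+x⇒w-x≈y-z (expanded a z b) ⟩
    (1# * 1# + z * (a * (z * b))) - (1# * (a * (z * b)) + z * 1#)
      ≈⟨ [w-x][y-z]≈[wy+xz]-[wz+xy] 1# z 1# (a * (z * b)) ⟨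
    (1# - z) * (1# - a * (z * b))
      ∎
    where
    expanded : ∀ a z b →
      ((1# * 1# + z * b * (a * z)) + (z * 1# * b + z * a * 1#)) + (1# * (a * (z * b)) + z * 1#)
        ≈ (1# * 1# + z * (a * (z * b))) + ((1# * (a * z) + z * b * 1#) + (z * 1# * 1# + z * a * b))
    expanded = solve 3 (λ a z b →
      ((con 1 :* con 1 :+ z :* b :* (a :* z)) :+ (z :* con 1 :* b :+ z :* a :* con 1))
        :+ (con 1 :* (a :* (z :* b)) :+ z :* con 1)
      := (con 1 :* con 1 :+ z :* (a :* (z :* b)))
        :+ ((con 1 :* (a :* z) :+ z :* b :* con 1) :+ (z :* con 1 :* con 1 :+ z :* a :* b))) refl

  sumFin≡sum : ∀ {m} (f : Fin m → Carrier) → sumFin R m f ≡ Sum.sum f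
  sumFin≡sum {zero} f = P.refl
  sumFin≡sum {suc m} f = P.cong (f zero +_) (sumFin≡sum (f ∘ suc))

  prodFin≡product : ∀ {m} (f : Fin m → Carrier) → prodFin R m f ≡ Product.sum f
  prodFin≡product {zero} f = P.refl
  prodFin≡product {suc m} f = P.cong (f zero *_) (prodFin≡product (f ∘ suc))

  sumFin-cong : ∀ {m} {f g : Fin m → Carrier} → (∀ j → f j ≈ g j) → sumFin R m f ≈ sumFin R m g
  sumFin-cong {f = f} {g} f≈g = begin
    sumFin R _ f  ≡⟨ sumFin≡sum f ⟩
    Sum.sum f     ≈⟨ Sum.sum-cong-≋ {x = f} {y = g} f≈g ⟩
    Sum.sum g     ≡⟨ sumFin≡sum g ⟨
    sumFin R _ g  ∎

  sumFin-zero : ∀ {m} {f : Fin m → Carrier} → (∀ j → f j ≈ 0#) → sumFin R m f ≈ 0#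
  sumFin-zero {m} {f} f≈0 = begin
    sumFin R m f               ≈⟨ sumFin-cong {g = λ _ → 0#} f≈0 ⟩
    sumFin R m (λ _ → 0#)      ≡⟨ sumFin≡sum {m} (λ _ → 0#) ⟩
    Sum.sum {m} (λ _ → 0#)     ≈⟨ Sum.sum-replicate-zero m ⟩
    0#                         ∎

  sumFin-linear : ∀ {m} {f g h : Fin m → Carrier} {a b} → (∀ j → f j ≈ a * g j + b * h j) →
                  sumFin R m f ≈ a * sumFin R m g + b * sumFin R m h
  sumFin-linear {m} {f} {g} {h} {a} {b} f≈ag+bh = begin
    sumFin R m f                                     ≈⟨ sumFin-cong {g = λ j → a * g j + b * h j} f≈ag+bh ⟩
    sumFin R m (λ j → a * g j + b * h j)             ≡⟨ sumFin≡sum (λ j → a * g j + b * h j) ⟩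
    Sum.sum (λ j → a * g j + b * h j)                ≈⟨ Sum.∑-distrib-+ (λ j → a * g j) (λ j → b * h j) ⟩
    Sum.sum (λ j → a * g j) + Sum.sum (λ j → b * h j)
      ≈⟨ +-cong (Sum.*-distribˡ-sum a g) (Sum.*-distribˡ-sum b h) ⟨
    a * Sum.sum g + b * Sum.sum h
      ≡⟨ P.cong₂ (λ u v → a * u + b * v) (sumFin≡sum g) (sumFin≡sum h) ⟨
    a * sumFin R m g + b * sumFin R m h              ∎

  prodFin-cong : ∀ {m} {f g : Fin m → Carrier} → (∀ j → f j ≈ g j) → prodFin R m f ≈ prodFin R m g
  prodFin-cong {f = f} {g} f≈g = begin
    prodFin R _ f  ≡⟨ prodFin≡product f ⟩
    Product.sum f  ≈⟨ Product.sum-cong-≋ {x = f} {y = g} f≈g ⟩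
    Product.sum g  ≡⟨ prodFin≡product g ⟨
    prodFin R _ g  ∎

  prodFin-init-last : ∀ {m} (f : Fin (suc m) → Carrier) →
                      prodFin R (suc m) f ≈ prodFin R m (f ∘ inject₁) * f (fromℕ m)
  prodFin-init-last {m} f = begin
    prodFin R _ f                               ≡⟨ prodFin≡product f ⟩
    Product.sum f                               ≈⟨ Product.sum-init-last f ⟩
    Product.sum (f ∘ inject₁) * f (fromℕ _)
      ≡⟨ P.cong (_* f (fromℕ m)) (prodFin≡product {m} (f ∘ inject₁)) ⟨
    prodFin R _ (f ∘ inject₁) * f (fromℕ _)     ∎

  prodFin-*-const : ∀ m (f : Fin m → Carrier) h → prodFin R m (λ j → f j * h) ≈ prodFin R m f * pow R h m
  prodFin-*-const m f h = begin
    prodFin R m (λ j → f j * h)                    ≡⟨ prodFin≡product (λ j → f j * h) ⟩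
    Product.sum (λ j → f j * h)                    ≈⟨ Product.∑-distrib-+ f (λ _ → h) ⟩
    Product.sum f * Product.sum (λ (_ : Fin m) → h)
      ≡⟨ P.cong₂ _*_ (prodFin≡product f) (prodFin≡product {m} (λ _ → h)) ⟨
    prodFin R m f * prodFin R m (λ _ → h)          ≈⟨ *-congˡ (prodFin-const m) ⟩
    prodFin R m f * pow R h m                      ∎
    where
    prodFin-const : ∀ m → prodFin R m (λ _ → h) ≈ pow R h m
    prodFin-const zero = refl
    prodFin-const (suc m) = *-congˡ (prodFin-const m)

  Matrix : ℕ → Set c
  Matrix m = Fin m → Fin m → Carrier

  minor : ∀ {m} → Matrix (suc m) → Fin (suc m) → Matrix m
  minor A j i k = A (suc i) (punchIn j k)

  cofactorTerm : ∀ {m} → Matrix (suc m) → Fin (suc m) → Carrier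
  cofactorTerm {m} A j = pow R (- 1#) (toℕ j) * (A zero j * det R m (minor A j))

  det-cong : ∀ m {A B : Matrix m} → (∀ i k → A i k ≈ B i k) → det R m A ≈ det R m B
  det-cong zero A≈B = refl
  det-cong (suc m) {A} {B} A≈B =
    sumFin-cong {f = cofactorTerm A} {cofactorTerm B} λ j →
      *-congˡ (*-cong (A≈B zero j) (det-cong m (λ i k → A≈B (suc i) (punchIn j k))))

  AgreeOffCol₀ : ∀ {m} → Matrix (suc m) → Matrix (suc m) → Set ℓ
  AgreeOffCol₀ A B = ∀ i k → A i (suc k) ≈ B i (suc k)

  det-linear-col₀ : ∀ m {A B C : Matrix (suc m)} {a b} → AgreeOffCol₀ A B → AgreeOffCol₀ A C →
                    (∀ i → A i zero ≈ a * B i zero + b * C i zero) →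
                    det R (suc m) A ≈ a * det R (suc m) B + b * det R (suc m) C
  cofactorTerm-linear-col₀ : ∀ m {A B C : Matrix (suc m)} {a b} → AgreeOffCol₀ A B → AgreeOffCol₀ A C →
                             (∀ i → A i zero ≈ a * B i zero + b * C i zero) →
                             ∀ j → cofactorTerm A j ≈ a * cofactorTerm B j + b * cofactorTerm C j

  det-linear-col₀ m {A} {B} {C} A~B A~C col₀ =
    sumFin-linear {f = cofactorTerm A} {cofactorTerm B} {cofactorTerm C}
                  (cofactorTerm-linear-col₀ m {A} {B} {C} A~B A~C col₀)

  cofactorTerm-linear-col₀ m {A} {B} {C} {a} {b} A~B A~C col₀ zero = begin
    1# * (A zero zero * d)                                    ≈⟨ *-congˡ (*-congʳ (col₀ zero)) ⟩
    1# * ((a * B zero zero + b * C zero zero) * d)            ≈⟨ distribute a b (B zero zero) (C zero zero) d ⟩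
    a * (1# * (B zero zero * d)) + b * (1# * (C zero zero * d))
      ≈⟨ +-cong (*-congˡ (*-congˡ (*-congˡ (det-cong m (λ i k → A~B (suc i) k)))))
                (*-congˡ (*-congˡ (*-congˡ (det-cong m (λ i k → A~C (suc i) k))))) ⟩
    a * cofactorTerm B zero + b * cofactorTerm C zero          ∎
    where
    d : Carrier
    d = det R m (minor A zero)
    distribute : ∀ a b u v d → 1# * ((a * u + b * v) * d) ≈ a * (1# * (u * d)) + b * (1# * (v * d))
    distribute = solve 5 (λ a b u v d →
      con 1 :* ((a :* u :+ b :* v) :* d) := a :* (con 1 :* (u :* d)) :+ b :* (con 1 :* (v :* d))) refl
  cofactorTerm-linear-col₀ (suc m) {A} {B} {C} {a} {b} A~B A~C col₀ (suc j) = begin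
    s * (A zero (suc j) * det R (suc m) (minor A (suc j)))
      ≈⟨ *-congˡ (*-congˡ (det-linear-col₀ m {minor A (suc j)} {minor B (suc j)} {minor C (suc j)}
                                               (λ i k → A~B (suc i) (punchIn j k))
                                               (λ i k → A~C (suc i) (punchIn j k)) (col₀ ∘ suc))) ⟩
    s * (A zero (suc j) * (a * dB + b * dC))
      ≈⟨ distribute a b s (A zero (suc j)) dB dC ⟩
    a * (s * (A zero (suc j) * dB)) + b * (s * (A zero (suc j) * dC))
      ≈⟨ +-cong (*-congˡ (*-congˡ (*-congʳ (A~B zero j)))) (*-congˡ (*-congˡ (*-congʳ (A~C zero j)))) ⟩
    a * cofactorTerm B (suc j) + b * cofactorTerm C (suc j)
      ∎
    where
    s dB dC : Carrier
    s = pow R (- 1#) (toℕ (suc j))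
    dB = det R (suc m) (minor B (suc j))
    dC = det R (suc m) (minor C (suc j))
    distribute : ∀ a b s u x y → s * (u * (a * x + b * y)) ≈ a * (s * (u * x)) + b * (s * (u * y))
    distribute = solve 6 (λ a b s u x y →
      s :* (u :* (a :* x :+ b :* y)) := a :* (s :* (u :* x)) :+ b :* (s :* (u :* y))) refl

  det-scale-col₀ : ∀ m {A B : Matrix (suc m)} {a} → AgreeOffCol₀ A B → (∀ i → A i zero ≈ a * B i zero) →
                   det R (suc m) A ≈ a * det R (suc m) B
  det-scale-col₀ m {A} {B} {a} A~B col₀ = begin
    det R (suc m) A                              ≈⟨ det-linear-col₀ m {A} {B} {B} {a} {0#} A~B A~B
                                                      (λ i → trans (col₀ i) (sym (+0* _ _))) ⟩
    a * det R (suc m) B + 0# * det R (suc m) B  ≈⟨ +0* _ _ ⟩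
    a * det R (suc m) B                          ∎
    where
    +0* : ∀ u v → u + 0# * v ≈ u
    +0* u v = trans (+-congˡ (zeroˡ v)) (+-identityʳ u)

  det-zero-col₀ : ∀ m {A : Matrix (suc m)} → (∀ i → A i zero ≈ 0#) → det R (suc m) A ≈ 0#
  det-zero-col₀ m {A} col₀ =
    trans (det-scale-col₀ m {A} {A} (λ _ _ → refl) (λ i → trans (col₀ i) (sym (zeroˡ (A i zero))))) (zeroˡ _)

  condense : ∀ {m} → Matrix (suc (suc m)) → Matrix (suc m)
  condense A i zero = A zero zero * A (suc i) (suc zero) - A zero (suc zero) * A (suc i) zero
  condense A i (suc k) = A (suc i) (suc (suc k))

  Cols₀₁Dependent : ∀ {r m} → (Fin r → Fin (suc (suc m)) → Carrier) → Set ℓ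
  Cols₀₁Dependent A = ∀ i i′ → A i zero * A i′ (suc zero) ≈ A i (suc zero) * A i′ zero

  det-condense : ∀ m {A : Matrix (suc (suc m))} → Cols₀₁Dependent (A ∘ suc) →
                 det R (suc (suc m)) A ≈ det R (suc m) (condense A)
  det-cols₀₁-dependent : ∀ m {A : Matrix (suc (suc m))} → Cols₀₁Dependent A → det R (suc (suc m)) A ≈ 0#
  cofactorTerms≥2-vanish : ∀ m {A : Matrix (suc (suc m))} → Cols₀₁Dependent (A ∘ suc) →
                           sumFin R m (λ j → cofactorTerm A (suc (suc j))) ≈ 0#

  -- Only the first two cofactor terms survive, and they are the expansion of
  -- the condensed matrix along its first column, which is linear.
  det-condense m {A} dependent = begin
    cofactorTerm A zero + (cofactorTerm A (suc zero) + rest)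
      ≈⟨ +-congˡ (+-congˡ (cofactorTerms≥2-vanish m {A} dependent)) ⟩
    cofactorTerm A zero + (cofactorTerm A (suc zero) + 0#)
      ≈⟨ +-cong (*-identityˡ _) (trans (+-identityʳ _) negated) ⟩
    A zero zero * det R (suc m) (minor A zero) + (- A zero (suc zero)) * det R (suc m) (minor A (suc zero))
      ≈⟨ det-linear-col₀ m {condense A} {minor A zero} {minor A (suc zero)}
                         (λ _ _ → refl) (λ _ _ → refl) (λ i → +-congˡ (-‿distribˡ-* _ _)) ⟨
    det R (suc m) (condense A)
      ∎
    where
    rest : Carrier
    rest = sumFin R m (λ j → cofactorTerm A (suc (suc j)))
    negated : cofactorTerm A (suc zero) ≈ (- A zero (suc zero)) * det R (suc m) (minor A (suc zero))
    negated = begin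
      (- 1# * 1#) * (A zero (suc zero) * d)  ≈⟨ *-congʳ (*-identityʳ _) ⟩
      - 1# * (A zero (suc zero) * d)         ≈⟨ -1*x≈-x _ ⟩
      - (A zero (suc zero) * d)              ≈⟨ -‿distribˡ-* _ _ ⟩
      (- A zero (suc zero)) * d              ∎
      where
      d : Carrier
      d = det R (suc m) (minor A (suc zero))

  det-cols₀₁-dependent m {A} dependent = begin
    det R (suc (suc m)) A       ≈⟨ det-condense m {A} (λ i i′ → dependent (suc i) (suc i′)) ⟩
    det R (suc m) (condense A)  ≈⟨ det-zero-col₀ m {condense A}
                                     (λ i → x≈y⇒x∙y⁻¹≈ε (dependent zero (suc i))) ⟩
    0#                          ∎

  cofactorTerms≥2-vanish zero dependent = refl
  cofactorTerms≥2-vanish (suc m) {A} dependent =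
    sumFin-zero {f = λ j → cofactorTerm A (suc (suc j))} λ j →
      trans (*-congˡ (trans (*-congˡ (det-cols₀₁-dependent m {minor A (suc (suc j))} dependent)) (zeroʳ _)))
            (zeroʳ _)

  -- A Green matrix has entries u (min i j) · v (max i j); here u i = α i / γ 0 i and
  -- v j = γ 0 j · β j, and keeping γ as data makes everything division-free.
  record GreenData : Set (c Level.⊔ ℓ) where
    field
      α β y : ℕ → Carrier
      γ : ℕ → ℕ → Carrier
      γ-diag : ∀ i → γ i i ≈ 1#
      γ-step : ∀ {i j} → i < j → γ i j ≈ y i * γ (suc i) j

  module _ (G : GreenData) where
    open GreenData G

    greenEntry : ℕ → ℕ → Carrier
    greenEntry a b = γ (a ⊓ b) (a ⊔ b) * (α (a ⊓ b) * β (a ⊔ b))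

    greenEntry-col₀ : ∀ a → greenEntry a 0 ≡ γ 0 a * (α 0 * β a)
    greenEntry-col₀ zero = P.refl
    greenEntry-col₀ (suc a) = P.refl

    green : ∀ {m} → Matrix m
    green i j = greenEntry (toℕ i) (toℕ j)

    green/α₀ : ∀ {m} → Matrix (suc m)
    green/α₀ i zero = γ 0 (toℕ i) * β (toℕ i)
    green/α₀ i (suc k) = green i (suc k)

    pivot : ℕ → Carrier
    pivot s = β s * α (suc s) - y s * y s * α s * β (suc s)

  shift : GreenData → GreenData
  shift G = record
    { α = α ∘ suc ; β = β ∘ suc ; y = y ∘ suc ; γ = λ i j → γ (suc i) (suc j)
    ; γ-diag = γ-diag ∘ suc ; γ-step = λ i<j → γ-step (s≤s i<j) }
    where open GreenData G

  det-green/α₀-step : ∀ m G →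
    det R (suc (suc m)) (green/α₀ G) ≈ pivot G 0 * det R (suc m) (green/α₀ (shift G))
  det-green/α₀-step m G = begin
    det R (suc (suc m)) (green/α₀ G)           ≈⟨ det-condense m {green/α₀ G} dependent ⟩
    det R (suc m) (condense (green/α₀ G))      ≈⟨ det-scale-col₀ m {condense (green/α₀ G)} {green/α₀ (shift G)}
                                                                   (λ _ _ → refl) condensed-col₀ ⟩
    pivot G 0 * det R (suc m) (green/α₀ (shift G)) ∎
    where
    open GreenData G
    γ₀-step : ∀ t → γ 0 (suc t) ≈ y 0 * γ 1 (suc t)
    γ₀-step t = γ-step (s≤s z≤n)
    γ₀₁ : γ 0 1 ≈ y 0
    γ₀₁ = trans (γ₀-step 0) (trans (*-congˡ (γ-diag 1)) (*-identityʳ _))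
    col₁ : ∀ (i : Fin (suc m)) →
           green/α₀ G (suc i) (suc zero) ≡ γ 1 (suc (toℕ i)) * (α 1 * β (suc (toℕ i)))
    col₁ i = greenEntry-col₀ (shift G) (toℕ i)
    dependent : Cols₀₁Dependent (green/α₀ G ∘ suc)
    dependent i i′ = begin
      (γ 0 a * β a) * green/α₀ G (suc i′) (suc zero)          ≡⟨ P.cong ((γ 0 a * β a) *_) (col₁ i′) ⟩
      (γ 0 a * β a) * (γ 1 b * (α 1 * β b))                   ≈⟨ *-congʳ (*-congʳ (γ₀-step (toℕ i))) ⟩
      ((y 0 * γ 1 a) * β a) * (γ 1 b * (α 1 * β b))           ≈⟨ swap (y 0) (γ 1 a) (β a) (γ 1 b) (α 1) (β b) ⟩
      (γ 1 a * (α 1 * β a)) * ((y 0 * γ 1 b) * β b)           ≈⟨ *-congˡ (*-congʳ (γ₀-step (toℕ i′))) ⟨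
      (γ 1 a * (α 1 * β a)) * (γ 0 b * β b)                   ≡⟨ P.cong (_* (γ 0 b * β b)) (col₁ i) ⟨
      green/α₀ G (suc i) (suc zero) * (γ 0 b * β b)           ∎
      where
      a b : ℕ
      a = suc (toℕ i)
      b = suc (toℕ i′)
      swap : ∀ y u βa v α₁ βb → ((y * u) * βa) * (v * (α₁ * βb)) ≈ (u * (α₁ * βa)) * ((y * v) * βb)
      swap = solve 6 (λ y u βa v α₁ βb →
        ((y :* u) :* βa) :* (v :* (α₁ :* βb)) := (u :* (α₁ :* βa)) :* ((y :* v) :* βb)) refl
    condensed-col₀ : ∀ i → condense (green/α₀ G) i zero ≈ pivot G 0 * green/α₀ (shift G) i zero
    condensed-col₀ i = begin
      (γ 0 0 * β 0) * green/α₀ G (suc i) (suc zero) - (γ 0 1 * (α 0 * β 1)) * (γ 0 a * β a)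
        ≈⟨ +-cong (trans (*-cong (*-congʳ (γ-diag 0)) (reflexive (col₁ i))) (first (β 0) (α 1) (γ 1 a) (β a)))
                  (-‿cong (trans (*-cong (*-congʳ γ₀₁) (*-congʳ (γ₀-step (toℕ i))))
                                 (second (y 0) (α 0) (β 1) (γ 1 a) (β a)))) ⟩
      (β 0 * α 1) * (γ 1 a * β a) - (y 0 * y 0 * α 0 * β 1) * (γ 1 a * β a)
        ≈⟨ [y-z]x≈yx-zx _ _ _ ⟨
      pivot G 0 * (γ 1 a * β a)
        ∎
      where
      a : ℕ
      a = suc (toℕ i)
      first : ∀ β₀ α₁ u βa → (1# * β₀) * (u * (α₁ * βa)) ≈ (β₀ * α₁) * (u * βa)
      first = solve 4 (λ β₀ α₁ u βa →
        (con 1 :* β₀) :* (u :* (α₁ :* βa)) := (β₀ :* α₁) :* (u :* βa)) refl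
      second : ∀ y α₀ β₁ u βa → (y * (α₀ * β₁)) * ((y * u) * βa) ≈ (y * y * α₀ * β₁) * (u * βa)
      second = solve 5 (λ y α₀ β₁ u βa →
        (y :* (α₀ :* β₁)) :* ((y :* u) :* βa) := (y :* y :* α₀ :* β₁) :* (u :* βa)) refl

  det-green/α₀ : ∀ m G → det R (suc m) (green/α₀ G) ≈ prodFin R m (pivot G ∘ toℕ) * GreenData.β G m
  det-green/α₀ zero G = begin
    1# * ((γ 0 0 * β 0) * 1#) + 0#  ≈⟨ +-identityʳ _ ⟩
    1# * ((γ 0 0 * β 0) * 1#)       ≈⟨ *-congˡ (*-identityʳ _) ⟩
    1# * (γ 0 0 * β 0)              ≈⟨ *-congˡ (trans (*-congʳ (γ-diag 0)) (*-identityˡ _)) ⟩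
    1# * β 0                        ∎
    where open GreenData G
  det-green/α₀ (suc m) G = begin
    det R (suc (suc m)) (green/α₀ G)                               ≈⟨ det-green/α₀-step m G ⟩
    pivot G 0 * det R (suc m) (green/α₀ (shift G))                 ≈⟨ *-congˡ (det-green/α₀ m (shift G)) ⟩
    pivot G 0 * (prodFin R m (pivot G ∘ suc ∘ toℕ) * β (suc m))    ≈⟨ *-assoc _ _ _ ⟨
    (pivot G 0 * prodFin R m (pivot G ∘ suc ∘ toℕ)) * β (suc m)   ∎
    where open GreenData G

  det-green : ∀ m G →
    det R (suc m) (green G) ≈ GreenData.α G 0 * (prodFin R m (pivot G ∘ toℕ) * GreenData.β G m)
  det-green m G = begin
    det R (suc m) (green G)                ≈⟨ det-scale-col₀ m {green G} {green/α₀ G} (λ _ _ → refl) col₀ ⟩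
    α 0 * det R (suc m) (green/α₀ G)       ≈⟨ *-congˡ (det-green/α₀ m G) ⟩
    α 0 * (prodFin R m (pivot G ∘ toℕ) * β m) ∎
    where
    open GreenData G
    col₀ : ∀ i → green G i zero ≈ α 0 * green/α₀ G i zero
    col₀ i = trans (reflexive (greenEntry-col₀ G (toℕ i))) (x∙yz≈y∙xz _ _ _)

  prodX-empty : ∀ n (g : Fin n → Carrier) a → prodX R n g a a ≈ 1#
  prodX-empty zero g a = refl
  prodX-empty (suc n) g zero = trans (*-identityˡ _) (prodX-empty n (g ∘ suc) zero)
  prodX-empty (suc n) g (suc a) = trans (*-identityˡ _) (prodX-empty n (g ∘ suc) a)

  prodX-split : ∀ n (g : Fin n → Carrier) {a b d} → a ≤ b → b ≤ d →
                prodX R n g a d ≈ prodX R n g a b * prodX R n g b d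
  prodX-split zero g _ _ = sym (*-identityˡ 1#)
  prodX-split (suc n) g {zero} {zero} {d} _ _ =
    sym (trans (*-congʳ (prodX-empty (suc n) g 0)) (*-identityˡ _))
  prodX-split (suc n) g {zero} {suc b} {suc d} _ (s≤s b≤d) = begin
    g zero * Π 0 d               ≈⟨ *-congˡ (prodX-split n (g ∘ suc) z≤n b≤d) ⟩
    g zero * (Π 0 b * Π b d)     ≈⟨ *-assoc _ _ _ ⟨
    (g zero * Π 0 b) * Π b d     ≈⟨ *-congˡ (*-identityˡ _) ⟨
    (g zero * Π 0 b) * (1# * Π b d) ∎
    where
    Π : ℕ → ℕ → Carrier
    Π = prodX R n (g ∘ suc)
  prodX-split (suc n) g {suc a} {suc b} {suc d} (s≤s a≤b) (s≤s b≤d) = begin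
    1# * Π a d                   ≈⟨ *-identityˡ _ ⟩
    Π a d                        ≈⟨ prodX-split n (g ∘ suc) a≤b b≤d ⟩
    Π a b * Π b d                ≈⟨ *-cong (*-identityˡ _) (*-identityˡ _) ⟨
    (1# * Π a b) * (1# * Π b d)  ∎
    where
    Π : ℕ → ℕ → Carrier
    Π = prodX R n (g ∘ suc)

  prodX-single : ∀ n (g : Fin n → Carrier) {a} (k : Fin n) → toℕ k ≡ a → prodX R n g a (suc a) ≈ g k
  prodX-single (suc n) g zero P.refl = trans (*-congˡ (prodX-empty n (g ∘ suc) 0)) (*-identityʳ _)
  prodX-single (suc n) g (suc k) P.refl = trans (*-identityˡ _) (prodX-single n (g ∘ suc) k P.refl)

  module _ (n : ℕ) (x : Fin n → Carrier) where

    squares : Fin n → Carrier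
    squares k = x k * x k

    -- With 0-based indices, α i = 1 - x₁² ⋯ x_{i+1}², β j = 1 - x_{j+2}² ⋯ x_n²,
    -- y i = x_{i+2} and γ i j = x_{i+2} ⋯ x_{j+1}, so that green is Lⁿ on the nose.
    greenL : GreenData
    greenL = record
      { α = λ i → 1# - prodSqX R n x 0 (suc i)
      ; β = λ j → 1# - prodSqX R n x (suc j) n
      ; y = λ i → prodX R n x (suc i) (suc (suc i))
      ; γ = λ i j → prodX R n x (suc i) (suc j)
      ; γ-diag = λ i → prodX-empty n x (suc i)
      ; γ-step = λ i<j → prodX-split n x (n≤1+n _) (s≤s i<j)
      }

    1-prodSqX-single : ∀ {a} (k : Fin n) → toℕ k ≡ a → 1# - prodSqX R n x a (suc a) ≈ 1# - squares k
    1-prodSqX-single k eq = +-congˡ (-‿cong (prodX-single n squares k eq))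

    pivot-greenL : ∀ s (k : Fin n) → toℕ k ≡ suc s →
                   pivot greenL s ≈ (1# - squares k) * (1# - prodSqX R n x 0 n)
    pivot-greenL s k eq = begin
      (1# - Q (suc s) n) * (1# - Q 0 (suc (suc s))) - ys * ys * (1# - a) * (1# - b)
        ≈⟨ +-cong (*-cong (+-congˡ (-‿cong zb)) (+-congˡ (-‿cong az)))
                  (-‿cong (*-congʳ (*-congʳ ys²≈z))) ⟩
      (1# - z * b) * (1# - a * z) - z * (1# - a) * (1# - b)
        ≈⟨ [1-zb][1-az]-z[1-a][1-b]≈[1-z][1-azb] a z b ⟩
      (1# - z) * (1# - a * (z * b))
        ≈⟨ *-cong (1-prodSqX-single k eq) (+-congˡ (-‿cong (sym (trans azb (*-congˡ zb))))) ⟩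
      (1# - squares k) * (1# - Q 0 n)
        ∎
      where
      Q : ℕ → ℕ → Carrier
      Q = prodSqX R n x
      ys a z b : Carrier
      ys = prodX R n x (suc s) (suc (suc s))
      a = Q 0 (suc s)
      z = Q (suc s) (suc (suc s))
      b = Q (suc (suc s)) n
      s+1<n : suc s < n
      s+1<n = P.subst (_< n) eq (toℕ<n k)
      zb : Q (suc s) n ≈ z * b
      zb = prodX-split n squares (n≤1+n _) s+1<n
      az : Q 0 (suc (suc s)) ≈ a * z
      az = prodX-split n squares z≤n (n≤1+n _)
      azb : Q 0 n ≈ a * Q (suc s) n
      azb = prodX-split n squares z≤n (<⇒≤ s+1<n)
      ys²≈z : ys * ys ≈ z
      ys²≈z = trans (*-cong (prodX-single n x k eq) (prodX-single n x k eq)) (sym (prodX-single n squares k eq))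

  det-L : ∀ m (x : Fin (suc (suc m)) → Carrier) → det R (suc m) (L R (suc (suc m)) x) ≈ rhs R (suc (suc m)) x
  det-L m x = begin
    det R (suc m) (green G)
      ≈⟨ det-green m G ⟩
    α 0 * (prodFin R m (pivot G ∘ toℕ) * β m)
      ≈⟨ *-cong (1-prodSqX-single n x zero P.refl)
                (*-cong (prodFin-cong {f = pivot G ∘ toℕ} {λ s → f (suc (inject₁ s)) * H} middle)
                        (1-prodSqX-single n x (fromℕ (suc m)) (toℕ-fromℕ (suc m)))) ⟩
    f zero * (prodFin R m (λ s → f (suc (inject₁ s)) * H) * f (fromℕ (suc m)))
      ≈⟨ *-congˡ (*-congʳ (prodFin-*-const m (f ∘ suc ∘ inject₁) H)) ⟩
    f zero * ((prodFin R m (f ∘ suc ∘ inject₁) * pow R H m) * f (fromℕ (suc m)))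
      ≈⟨ trans (*-congˡ (xy∙z≈xz∙y _ _ _)) (sym (*-assoc _ _ _)) ⟩
    (f zero * (prodFin R m (f ∘ suc ∘ inject₁) * f (fromℕ (suc m)))) * pow R H m
      ≈⟨ *-congʳ (*-congˡ (prodFin-init-last (f ∘ suc))) ⟨
    rhs R n x
      ∎
    where
    n : ℕ
    n = suc (suc m)
    G : GreenData
    G = greenL n x
    open GreenData G
    f : Fin n → Carrier
    f k = 1# - squares n x k
    H : Carrier
    H = 1# - prodSqX R n x 0 n
    middle : ∀ s → pivot G (toℕ s) ≈ f (suc (inject₁ s)) * H
    middle s = pivot-greenL n x (toℕ s) (suc (inject₁ s)) (P.cong suc (toℕ-inject₁ s))

-- The hypothesis 3 ≤ n is stronger than needed: the identity also holds for n = 2.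
mainTheorem3 : {c ℓ : Level} (R : CommutativeRing c ℓ) (n : ℕ) → 3 ≤ n →
    (x : Fin n → CommutativeRing.Carrier R) →
    CommutativeRing._≈_ R (det R (n ∸ 1) (L R n x)) (rhs R n x)
mainTheorem3 R (suc (suc m)) (s≤s (s≤s _)) x = det-L R m x
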